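{- For any $\Pi^0_1$ class $Q\subseteq{}^\omega 2$ with no recursive element and any $g\in Q$, $Q\setminus\{g\}\le_{\mathsf w}\mathsf{DNR}_2$.
   Context: $Q\subseteq{}^\omega2$ is a $\Pi^0_1$ class iff it is the set of infinite paths through a recursive tree $T\subseteq{}^{<\omega}2$. For $P,R\subseteq{}^\omega\omega$, $P\le_{\mathsf w}R$ iff for every $g\in R$ there is $f\in P$ with $f\le_T g$ (Turing reducibility). $\mathsf{DNR}_2:=\{f\in{}^\omega 2:\forall a\ [f(a)\neq\{a\}(a)]\}$, where $(\{a\})_{a\in\omega}$ is a standard enumeration of the partial recursive functions and $f(a)\neq\{a\}(a)$ holds in particular when $\{a\}(a)$ is undefined. -}

module Defs where

open import Level using (0ℓ)
open import Data.Nat using (ℕ; zero; suc; _+_; _*_; _^_; _<_)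
open import Data.Fin using (Fin; toℕ)
open import Data.Vec using (Vec; []; _∷_; lookup)
open import Data.List using (List; []; _∷_; _++_; applyUpTo)
open import Data.Bool using (Bool; true; false)
open import Data.Product using (Σ; ∃; _×_)
open import Relation.Binary.PropositionalEquality using (_≡_; _≢_)
open import Relation.Nullary using (¬_)

-- Oracle partial recursive functions (Kleene's mu-recursive functions
-- relative to an oracle O : ℕ → ℕ), indexed by arity.

data Code : ℕ → Set where
  zeroC   : ∀ {n} → Code n
  succC   : Code 1
  projC   : ∀ {n} → Fin n → Code n
  oracleC : Code 1
  compC   : ∀ {m n} → Code m → Vec (Code n) m → Code n
  precC   : ∀ {n} → Code n → Code (suc (suc n)) → Code (suc n)
  muC     : ∀ {n} → Code (suc n) → Code n

Oracle : Set
Oracle = ℕ → ℕ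

-- Big-step (partial, deterministic) semantics:  Eval O c xs y  means
-- "Φ_c^O(xs) converges with value y".
mutual
  data Eval (O : Oracle) : ∀ {n} → Code n → Vec ℕ n → ℕ → Set where
    ev-zero   : ∀ {n} {xs : Vec ℕ n} → Eval O zeroC xs 0
    ev-succ   : ∀ {x} → Eval O succC (x ∷ []) (suc x)
    ev-proj   : ∀ {n} {i : Fin n} {xs} → Eval O (projC i) xs (lookup xs i)
    ev-oracle : ∀ {x} → Eval O oracleC (x ∷ []) (O x)
    ev-comp   : ∀ {m n} {f : Code m} {gs : Vec (Code n) m} {xs ys y} →
                EvalVec O gs xs ys → Eval O f ys y → Eval O (compC f gs) xs y
    ev-prec0  : ∀ {n} {f : Code n} {h} {xs y} →
                Eval O f xs y → Eval O (precC f h) (0 ∷ xs) y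
    ev-precS  : ∀ {n} {f : Code n} {h} {k xs r y} →
                Eval O (precC f h) (k ∷ xs) r → Eval O h (k ∷ r ∷ xs) y →
                Eval O (precC f h) (suc k ∷ xs) y
    ev-mu     : ∀ {n} {f : Code (suc n)} {xs y} →
                Eval O f (y ∷ xs) 0 →
                (∀ k → k < y → Σ ℕ (λ v → Eval O f (k ∷ xs) (suc v))) →
                Eval O (muC f) xs y

  data EvalVec (O : Oracle) {n : ℕ} : ∀ {m} → Vec (Code n) m → Vec ℕ n → Vec ℕ m → Set where
    evv-nil  : ∀ {xs} → EvalVec O [] xs []
    evv-cons : ∀ {m} {g} {gs : Vec (Code n) m} {xs y ys} →
               Eval O g xs y → EvalVec O gs xs ys → EvalVec O (g ∷ gs) xs (y ∷ ys)

pair : ℕ → ℕ → ℕ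
pair a b = 2 ^ a * suc (2 * b)

mutual
  encode : ∀ {n} → Code n → ℕ
  encode {n} c = pair n (body c)

  body : ∀ {n} → Code n → ℕ
  body zeroC        = pair 0 0
  body succC        = pair 1 0
  body (projC i)    = pair 2 (toℕ i)
  body oracleC      = pair 3 0
  body (compC f gs) = pair 4 (pair (encode f) (encodeVec gs))
  body (precC f h)  = pair 5 (pair (encode f) (encode h))
  body (muC f)      = pair 6 (encode f)

  encodeVec : ∀ {m n} → Vec (Code n) m → ℕ
  encodeVec []       = 0
  encodeVec (g ∷ gs) = suc (pair (encode g) (encodeVec gs))

-- The standard enumeration of unary partial recursive functions:
-- {a}(x) ≃ y  iff  a is the number of a unary code c and Φ_c(x) ≃ y
-- (without oracle); numbers that code no unary program index the
-- nowhere-defined function.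
emptyOracle : Oracle
emptyOracle _ = 0

_[_]≃_ : ℕ → ℕ → ℕ → Set
a [ x ]≃ y = Σ (Code 1) (λ c → encode c ≡ a × Eval emptyOracle c (x ∷ []) y)

Cantor : Set
Cantor = ℕ → Bool

b2n : Bool → ℕ
b2n false = 0
b2n true  = 1

_≤T_ : Cantor → Cantor → Set
f ≤T g = Σ (Code 1) (λ c → ∀ n → Eval (λ k → b2n (g k)) c (n ∷ []) (b2n (f n)))

Recursive : Cantor → Set
Recursive f = Σ (Code 1) (λ c → ∀ n → Eval emptyOracle c (n ∷ []) (b2n (f n)))

codeStr : List Bool → ℕ
codeStr []           = 0
codeStr (false ∷ σ)  = suc (2 * codeStr σ)
codeStr (true ∷ σ)   = suc (suc (2 * codeStr σ))

IsRecursiveTree : (List Bool → Bool) → Set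
IsRecursiveTree T =
  (Σ (Code 1) (λ c → ∀ σ → Eval emptyOracle c (codeStr σ ∷ []) (b2n (T σ))))
  × (∀ σ b → T (σ ++ (b ∷ [])) ≡ true → T σ ≡ true)

-- f ↾ n = (f 0, …, f (n-1))
IsPath : (List Bool → Bool) → Cantor → Set
IsPath T f = ∀ n → T (applyUpTo f n) ≡ true

Class : Set₁
Class = Cantor → Set

IsΠ⁰₁ : Class → Set
IsΠ⁰₁ Q = Σ (List Bool → Bool) (λ T → IsRecursiveTree T ×
            (∀ f → (Q f → IsPath T f) × (IsPath T f → Q f)))

_≤w_ : Class → Class → Set
P ≤w R = ∀ g → R g → Σ Cantor (λ f → P f × f ≤T g)

DNR₂ : Class
DNR₂ f = ∀ a y → a [ a ]≃ y → b2n (f a) ≢ y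

_∖｛_｝ : Class → Cantor → Class
(Q ∖｛ g ｝) f = Q f × ¬ (∀ n → f n ≡ g n)

module Submission where

-- Let T be a recursive tree whose paths form Q.  If some deviation g ↾ n ++ [ not (g n) ] from g
-- is extendible, a DNR₂ function h computes a path through the subtree above it, and prefixing
-- the deviation yields an element of Q ∖ {g} computable from h.  The path is built node by node:
-- at an extendible node σ, a program searches for the first level at which one of the two
-- children of σ has no extension in T and outputs whether the false-child is still alive there;
-- since h differs from that program's output at its own index, h names a child that is still
-- extendible (if the search diverges, both children are).  If instead no deviation from g is
-- extendible, the same search run along g finds, at every n, the level where the deviating
-- child dies and so computes g, contradicting that Q has no recursive element.

open import Defs
open import Level using (0ℓ)
open import Axiom.ExcludedMiddle using (ExcludedMiddle)
open import Axiom.DoubleNegationElimination using (em⇒dne)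
open import Data.Bool using (Bool; true; false; not; _∧_; _∨_)
open import Data.Bool.Properties using (_≟_; ¬-not; not-¬; ∧-zeroʳ; T-≡)
open import Data.Empty using (⊥-elim)
open import Data.Fin using (#_)
open import Data.Bool.ListAction using (any)
open import Data.List using (List; []; _∷_; _++_; _∷ʳ_; [_]; length; applyUpTo; downFrom; take; drop)
open import Data.List.Properties
  using (length-++; ++-assoc; ++-identityʳ; ∷ʳ-++; length-applyUpTo; applyUpTo-∷ʳ; take++drop≡id; length-take)
open import Data.List.Membership.Propositional using (find; lose)
open import Data.List.Membership.Propositional.Properties using (∈-downFrom⁺; ∈-downFrom⁻)
open import Data.List.Relation.Unary.Any.Properties using (any⁺; any⁻)
open import Data.Nat using (ℕ; zero; suc; _+_; _*_; _^_; _<_; _≤_; _∸_; pred; z≤n; s≤s; >-nonZero)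
open import Data.Nat.Induction using (<-rec)
open import Data.Nat.Properties hiding (_≟_)
open import Data.Nat.Tactic.RingSolver using (solve-∀)
open import Data.Product using (Σ; ∃; _×_; _,_; proj₁; proj₂)
open import Data.Vec using (Vec; []; _∷_)
open import Function.Base using (_∘_; case_of_)
open import Function.Bundles using (Equivalence)
open import Relation.Binary.PropositionalEquality hiding ([_])
open import Relation.Nullary using (¬_; yes; no)
open import Relation.Nullary.Decidable using (decidable-stable)
open import Relation.Unary using (Decidable)

private variable
  n m : ℕ
  b : Bool
  σ τ ρ : List Bool

codeStr-∷ : ∀ b σ → codeStr (b ∷ σ) ≡ suc (b2n b + 2 * codeStr σ)
codeStr-∷ false σ = refl
codeStr-∷ true  σ = refl

codeStr-++ : ∀ σ ρ → codeStr (σ ++ ρ) ≡ codeStr σ + 2 ^ length σ * codeStr ρ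
codeStr-++ []      ρ = sym (+-identityʳ _)
codeStr-++ (b ∷ σ) ρ = begin
  codeStr (b ∷ σ ++ ρ)                                      ≡⟨ codeStr-∷ b (σ ++ ρ) ⟩
  suc (b2n b + 2 * codeStr (σ ++ ρ))                        ≡⟨ cong (λ x → suc (b2n b + 2 * x)) (codeStr-++ σ ρ) ⟩
  suc (b2n b + 2 * (codeStr σ + 2 ^ length σ * codeStr ρ))  ≡⟨ rearrange (b2n b) (codeStr σ) (2 ^ length σ) (codeStr ρ) ⟩
  suc (b2n b + 2 * codeStr σ) + 2 * 2 ^ length σ * codeStr ρ ≡⟨ cong (_+ 2 * 2 ^ length σ * codeStr ρ) (codeStr-∷ b σ) ⟨
  codeStr (b ∷ σ) + 2 ^ length (b ∷ σ) * codeStr ρ          ∎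
  where
  open ≡-Reasoning
  rearrange : ∀ x c p r → suc (x + 2 * (c + p * r)) ≡ suc (x + 2 * c) + 2 * p * r
  rearrange = solve-∀

codeStr-∷ʳ : ∀ σ b → codeStr (σ ∷ʳ b) ≡ codeStr σ + 2 ^ length σ * suc (b2n b)
codeStr-∷ʳ σ false = codeStr-++ σ [ false ]
codeStr-∷ʳ σ true  = codeStr-++ σ [ true ]

codeStr-injective : ∀ σ τ → codeStr σ ≡ codeStr τ → σ ≡ τ
codeStr-injective []          []          _  = refl
codeStr-injective []          (b ∷ τ)     eq = ⊥-elim (0≢1+n (trans eq (codeStr-∷ b τ)))
codeStr-injective (b ∷ σ)     []          eq = ⊥-elim (0≢1+n (trans (sym eq) (codeStr-∷ b σ)))
codeStr-injective (false ∷ σ) (false ∷ τ) eq =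
  cong (false ∷_) (codeStr-injective σ τ (*-cancelˡ-≡ _ _ 2 (suc-injective eq)))
codeStr-injective (true ∷ σ)  (true ∷ τ)  eq =
  cong (true ∷_) (codeStr-injective σ τ (*-cancelˡ-≡ _ _ 2 (suc-injective (suc-injective eq))))
codeStr-injective (false ∷ σ) (true ∷ τ)  eq = ⊥-elim (even≢odd (codeStr σ) (codeStr τ) (suc-injective eq))
codeStr-injective (true ∷ σ)  (false ∷ τ) eq = ⊥-elim (even≢odd (codeStr τ) (codeStr σ) (sym (suc-injective eq)))

next : List Bool → List Bool
next []          = [ false ]
next (false ∷ σ) = true ∷ σ
next (true ∷ σ)  = false ∷ next σ

codeStr-next : ∀ σ → codeStr (next σ) ≡ suc (codeStr σ)
codeStr-next []          = refl
codeStr-next (false ∷ σ) = refl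
codeStr-next (true ∷ σ)  = trans (cong (λ x → suc (2 * x)) (codeStr-next σ)) (cong suc (*-suc 2 (codeStr σ)))

decode : ℕ → List Bool
decode zero    = []
decode (suc x) = next (decode x)

codeStr-decode : ∀ x → codeStr (decode x) ≡ x
codeStr-decode zero    = refl
codeStr-decode (suc x) = trans (codeStr-next (decode x)) (cong suc (codeStr-decode x))

decode-codeStr : ∀ σ → decode (codeStr σ) ≡ σ
decode-codeStr σ = codeStr-injective _ _ (codeStr-decode (codeStr σ))

2^length≤suc-codeStr : ∀ ρ → 2 ^ length ρ ≤ suc (codeStr ρ)
2^length≤suc-codeStr []      = ≤-refl
2^length≤suc-codeStr (b ∷ ρ) = begin
  2 * 2 ^ length ρ              ≤⟨ *-monoʳ-≤ 2 (2^length≤suc-codeStr ρ) ⟩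
  2 * suc (codeStr ρ)           ≡⟨ *-suc 2 (codeStr ρ) ⟩
  2 + 2 * codeStr ρ             ≤⟨ +-monoʳ-≤ 2 (m≤n+m _ (b2n b)) ⟩
  2 + (b2n b + 2 * codeStr ρ)   ≡⟨ cong suc (codeStr-∷ b ρ) ⟨
  suc (codeStr (b ∷ ρ))         ∎
  where open ≤-Reasoning

suc-codeStr<2^suc-length : ∀ ρ → suc (codeStr ρ) < 2 ^ suc (length ρ)
suc-codeStr<2^suc-length []      = s≤s (s≤s z≤n)
suc-codeStr<2^suc-length (b ∷ ρ) = begin-strict
  suc (codeStr (b ∷ ρ))         ≡⟨ cong suc (codeStr-∷ b ρ) ⟩
  2 + (b2n b + 2 * codeStr ρ)   ≤⟨ +-monoʳ-≤ 2 (+-monoˡ-≤ _ (b2n≤1 b)) ⟩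
  2 + (1 + 2 * codeStr ρ)       <⟨ n<1+n _ ⟩
  4 + 2 * codeStr ρ             ≡⟨ *-distribˡ-+ 2 2 (codeStr ρ) ⟨
  2 * (2 + codeStr ρ)           ≤⟨ *-monoʳ-≤ 2 (suc-codeStr<2^suc-length ρ) ⟩
  2 * 2 ^ suc (length ρ)        ∎
  where
  open ≤-Reasoning
  b2n≤1 : ∀ b → b2n b ≤ 1
  b2n≤1 false = z≤n
  b2n≤1 true  = s≤s z≤n

2^m≤x<2^[1+k]⇒m≤k : ∀ {m k x} → 2 ^ m ≤ x → x < 2 ^ suc k → m ≤ k
2^m≤x<2^[1+k]⇒m≤k 2^m≤x x<2^[1+k] =
  ≮⇒≥ (λ k<m → <-irrefl refl (<-≤-trans x<2^[1+k] (≤-trans (^-monoʳ-≤ 2 k<m) 2^m≤x)))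

-- For r < 2 ^ m, the r-th string of length m: the strings of length m are exactly those
-- whose codes lie in [2 ^ m - 1, 2 ^ (m + 1) - 1).
strOf : ℕ → ℕ → List Bool
strOf m r = decode (pred (2 ^ m + r))

suc-codeStr-strOf : ∀ m r → suc (codeStr (strOf m r)) ≡ 2 ^ m + r
suc-codeStr-strOf m r = begin
  suc (codeStr (strOf m r)) ≡⟨ cong suc (codeStr-decode _) ⟩
  suc (pred (2 ^ m + r))    ≡⟨ suc-pred (2 ^ m + r) {{>-nonZero (<-≤-trans (m^n>0 2 m) (m≤m+n _ r))}} ⟩
  2 ^ m + r                 ∎
  where open ≡-Reasoning

2^m+r<2^[1+m] : ∀ m {r} → r < 2 ^ m → 2 ^ m + r < 2 ^ suc m
2^m+r<2^[1+m] m {r} r<2^m = begin-strict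
  2 ^ m + r            <⟨ +-monoʳ-< (2 ^ m) r<2^m ⟩
  2 ^ m + 2 ^ m        ≡⟨ cong (2 ^ m +_) (+-identityʳ (2 ^ m)) ⟨
  2 ^ suc m            ∎
  where open ≤-Reasoning

length-strOf : ∀ {m r} → r < 2 ^ m → length (strOf m r) ≡ m
length-strOf {m} {r} r<2^m = ≤-antisym
  (2^m≤x<2^[1+k]⇒m≤k (2^length≤suc-codeStr str) (subst (_< 2 ^ suc m) (sym (suc-codeStr-strOf m r)) (2^m+r<2^[1+m] m r<2^m)))
  (2^m≤x<2^[1+k]⇒m≤k (subst (2 ^ m ≤_) (sym (suc-codeStr-strOf m r)) (m≤m+n _ r)) (suc-codeStr<2^suc-length str))
  where
  str : List Bool
  str = strOf m r

strOf-surjective : ∀ ρ → ∃ λ r → r < 2 ^ length ρ × strOf (length ρ) r ≡ ρ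
strOf-surjective ρ = r , r<2^ℓ , trans (cong (decode ∘ pred) 2^ℓ+r≡x) (decode-codeStr ρ)
  where
  ℓ r : ℕ
  ℓ = length ρ
  r = suc (codeStr ρ) ∸ 2 ^ ℓ
  2^ℓ+r≡x : 2 ^ ℓ + r ≡ suc (codeStr ρ)
  2^ℓ+r≡x = m+[n∸m]≡n (2^length≤suc-codeStr ρ)
  r<2^ℓ : r < 2 ^ ℓ
  r<2^ℓ = +-cancelˡ-< (2 ^ ℓ) r (2 ^ ℓ)
    (subst₂ _<_ (sym 2^ℓ+r≡x) (cong (2 ^ ℓ +_) (+-identityʳ (2 ^ ℓ))) (suc-codeStr<2^suc-length ρ))

-- Programming with oracle codes

private variable
  O : Oracle
  xs : Vec ℕ n

app₁ : Code 1 → Code n → Code n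
app₁ f a = compC f (a ∷ [])

app₂ : Code 2 → Code n → Code n → Code n
app₂ f a b = compC f (a ∷ b ∷ [])

eval-app₁ : ∀ {f a x y} → Eval O {n} a xs x → Eval O f (x ∷ []) y → Eval O (app₁ f a) xs y
eval-app₁ ea ef = ev-comp (evv-cons ea evv-nil) ef

eval-app₂ : ∀ {f a b x x′ y} → Eval O {n} a xs x → Eval O b xs x′ → Eval O f (x ∷ x′ ∷ []) y →
            Eval O (app₂ f a b) xs y
eval-app₂ ea eb ef = ev-comp (evv-cons ea (evv-cons eb evv-nil)) ef

numeral : ℕ → Code n
numeral zero    = zeroC
numeral (suc k) = app₁ succC (numeral k)

eval-numeral : ∀ k → Eval O (numeral {n} k) xs k
eval-numeral zero    = ev-zero
eval-numeral (suc k) = eval-app₁ (eval-numeral k) ev-succ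

addC : Code 2
addC = precC (projC (# 0)) (app₁ succC (projC (# 1)))

eval-addC : ∀ x y → Eval O addC (x ∷ y ∷ []) (x + y)
eval-addC zero    y = ev-prec0 ev-proj
eval-addC (suc x) y = ev-precS (eval-addC x y) (eval-app₁ ev-proj ev-succ)

infixl 6 _⊕_
_⊕_ : Code n → Code n → Code n
_⊕_ = app₂ addC

eval-⊕ : ∀ {a b x y} → Eval O {n} a xs x → Eval O b xs y → Eval O (a ⊕ b) xs (x + y)
eval-⊕ ea eb = eval-app₂ ea eb (eval-addC _ _)

mulC : Code 2
mulC = precC zeroC (projC (# 2) ⊕ projC (# 1))

eval-mulC : ∀ x y → Eval O mulC (x ∷ y ∷ []) (x * y)
eval-mulC zero    y = ev-prec0 ev-zero
eval-mulC (suc x) y = ev-precS (eval-mulC x y) (eval-⊕ ev-proj ev-proj)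

infixl 7 _⊗_
_⊗_ : Code n → Code n → Code n
_⊗_ = app₂ mulC

eval-⊗ : ∀ {a b x y} → Eval O {n} a xs x → Eval O b xs y → Eval O (a ⊗ b) xs (x * y)
eval-⊗ ea eb = eval-app₂ ea eb (eval-mulC _ _)

exp2C : Code 1
exp2C = precC (numeral 1) (numeral 2 ⊗ projC (# 1))

eval-exp2C : ∀ x → Eval O exp2C (x ∷ []) (2 ^ x)
eval-exp2C zero    = ev-prec0 (eval-numeral 1)
eval-exp2C (suc x) = ev-precS (eval-exp2C x) (eval-⊗ (eval-numeral 2) ev-proj)

2^ᶜ_ : Code n → Code n
2^ᶜ_ = app₁ exp2C

eval-2^ᶜ : ∀ {a x} → Eval O {n} a xs x → Eval O (2^ᶜ a) xs (2 ^ x)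
eval-2^ᶜ ea = eval-app₁ ea (eval-exp2C _)

predC : Code 1
predC = precC zeroC (projC (# 0))

eval-predC : ∀ x → Eval O predC (x ∷ []) (pred x)
eval-predC zero    = ev-prec0 ev-zero
eval-predC (suc x) = ev-precS (eval-predC x) ev-proj

pairC : Code 2
pairC = 2^ᶜ projC (# 0) ⊗ app₁ succC (numeral 2 ⊗ projC (# 1))

⟪_,_⟫ : Code n → Code n → Code n
⟪_,_⟫ = app₂ pairC

eval-⟪,⟫ : ∀ {a b x y} → Eval O {n} a xs x → Eval O b xs y → Eval O ⟪ a , b ⟫ xs (pair x y)
eval-⟪,⟫ ea eb = eval-app₂ ea eb (eval-⊗ (eval-2^ᶜ ev-proj) (eval-app₁ (eval-⊗ (eval-numeral 2) ev-proj) ev-succ))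

orC : Code 2
orC = precC (projC (# 0)) (numeral 1)

eval-orC : ∀ a b → Eval O orC (b2n a ∷ b2n b ∷ []) (b2n (a ∨ b))
eval-orC false b = ev-prec0 ev-proj
eval-orC true  b = ev-precS (ev-prec0 ev-proj) (eval-numeral 1)

andC : Code 2
andC = precC zeroC (projC (# 2))

eval-andC : ∀ a b → Eval O andC (b2n a ∷ b2n b ∷ []) (b2n (a ∧ b))
eval-andC false b = ev-prec0 ev-zero
eval-andC true  b = ev-precS (ev-prec0 ev-zero) ev-proj

notC : Code 1
notC = precC (numeral 1) zeroC

eval-notC : ∀ a → Eval O notC (b2n a ∷ []) (b2n (not a))
eval-notC false = ev-prec0 (eval-numeral 1)
eval-notC true  = ev-precS (ev-prec0 (eval-numeral 1)) ev-zero

_↾_ : Cantor → ℕ → List Bool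
f ↾ n = applyUpTo f n

codeStr-↾-suc : ∀ (f : Cantor) n → codeStr (f ↾ suc n) ≡ codeStr (f ↾ n) + 2 ^ n * suc (b2n (f n))
codeStr-↾-suc f n = begin
  codeStr (f ↾ suc n)                                       ≡⟨ cong codeStr (applyUpTo-∷ʳ f n) ⟨
  codeStr (f ↾ n ∷ʳ f n)                                    ≡⟨ codeStr-∷ʳ (f ↾ n) (f n) ⟩
  codeStr (f ↾ n) + 2 ^ length (f ↾ n) * suc (b2n (f n))
    ≡⟨ cong (λ ℓ → codeStr (f ↾ n) + 2 ^ ℓ * suc (b2n (f n))) (length-applyUpTo f n) ⟩
  codeStr (f ↾ n) + 2 ^ n * suc (b2n (f n))                 ∎
  where open ≡-Reasoning

prefixCodeC : Code 2 → Code 1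
prefixCodeC ch = precC zeroC (projC (# 1) ⊕ 2^ᶜ projC (# 0) ⊗ app₁ succC (app₂ ch (projC (# 1)) (2^ᶜ projC (# 0))))

extendC : Code 2 → Code 1
extendC ch = app₂ ch (prefixCodeC ch) (2^ᶜ projC (# 0))

extendC-computes : ∀ {ch} {F : Cantor} →
                   (∀ n → Eval O ch (codeStr (F ↾ n) ∷ 2 ^ length (F ↾ n) ∷ []) (b2n (F n))) →
                   ∀ n → Eval O (extendC ch) (n ∷ []) (b2n (F n))
extendC-computes {O = O} {ch} {F} ch-next n = eval-app₂ (eval-prefixCodeC n) (eval-2^ᶜ ev-proj) (ch-next′ n)
  where
  ch-next′ : ∀ n → Eval O ch (codeStr (F ↾ n) ∷ 2 ^ n ∷ []) (b2n (F n))
  ch-next′ n = subst (λ ℓ → Eval O ch (codeStr (F ↾ n) ∷ 2 ^ ℓ ∷ []) (b2n (F n))) (length-applyUpTo F n) (ch-next n)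
  eval-prefixCodeC : ∀ n → Eval O (prefixCodeC ch) (n ∷ []) (codeStr (F ↾ n))
  eval-prefixCodeC zero    = ev-prec0 ev-zero
  eval-prefixCodeC (suc n) = subst (Eval O (prefixCodeC ch) (suc n ∷ [])) (sym (codeStr-↾-suc F n))
    (ev-precS (eval-prefixCodeC n)
      (eval-⊕ ev-proj (eval-⊗ (eval-2^ᶜ ev-proj)
        (eval-app₁ (eval-app₂ ev-proj (eval-2^ᶜ ev-proj) (ch-next′ n)) ev-succ))))

specialise : Code 2 → ℕ → ℕ → Code 1
specialise p c d = app₂ p (numeral c) (numeral d)

compIndexC : Code n → Code n → Code n
compIndexC f gs = ⟪ numeral 1 , ⟪ numeral 4 , ⟪ f , gs ⟫ ⟫ ⟫

eval-compIndexC : ∀ {m} (f : Code m) (gs : Vec (Code 1) m) {a b} →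
                  Eval O {n} a xs (encode f) → Eval O b xs (encodeVec gs) → Eval O (compIndexC a b) xs (encode (compC f gs))
eval-compIndexC f gs ea eb = eval-⟪,⟫ (eval-numeral 1) (eval-⟪,⟫ (eval-numeral 4) (eval-⟪,⟫ ea eb))

consIndexC : Code n → Code n → Code n
consIndexC g gs = app₁ succC ⟪ g , gs ⟫

eval-consIndexC : ∀ {m} (g : Code 1) (gs : Vec (Code 1) m) {a b} →
                  Eval O {n} a xs (encode g) → Eval O b xs (encodeVec gs) → Eval O (consIndexC a b) xs (encodeVec (g ∷ gs))
eval-consIndexC g gs ea eb = eval-app₁ (eval-⟪,⟫ ea eb) ev-succ

numeralIndexC : Code 1
numeralIndexC = precC (numeral (encode (zeroC {1}))) (compIndexC (numeral (encode succC)) (consIndexC (projC (# 1)) zeroC))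

eval-numeralIndexC : ∀ k → Eval O numeralIndexC (k ∷ []) (encode (numeral {1} k))
eval-numeralIndexC zero    = ev-prec0 (eval-numeral _)
eval-numeralIndexC (suc k) = ev-precS (eval-numeralIndexC k)
  (eval-compIndexC succC (numeral k ∷ []) (eval-numeral _) (eval-consIndexC (numeral k) [] ev-proj ev-zero))

specialiseIndexC : Code 2 → Code 2
specialiseIndexC p = compIndexC (numeral (encode p))
  (consIndexC (app₁ numeralIndexC (projC (# 0))) (consIndexC (app₁ numeralIndexC (projC (# 1))) zeroC))

eval-specialiseIndexC : ∀ p c d → Eval O (specialiseIndexC p) (c ∷ d ∷ []) (encode (specialise p c d))
eval-specialiseIndexC p c d = eval-compIndexC p (numeral c ∷ numeral d ∷ []) (eval-numeral (encode p))
  (eval-consIndexC (numeral c) (numeral d ∷ []) (eval-app₁ ev-proj (eval-numeralIndexC c))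
    (eval-consIndexC (numeral d) [] (eval-app₁ ev-proj (eval-numeralIndexC d)) ev-zero))

DNR₂-avoids-specialise : ∀ {h} → DNR₂ h → ∀ {p c d y} → Eval emptyOracle p (c ∷ d ∷ []) y →
                         b2n (h (encode (specialise p c d))) ≢ y
DNR₂-avoids-specialise dnr {p} {c} {d} {y} ev =
  dnr _ y (specialise p c d , refl , eval-app₂ (eval-numeral c) (eval-numeral d) ev)

-- Extendible nodes of a tree

PrefixClosed : (List Bool → Bool) → Set
PrefixClosed T = ∀ σ b → T (σ ++ (b ∷ [])) ≡ true → T σ ≡ true

Alive : (List Bool → Bool) → List Bool → ℕ → Set
Alive T σ m = ∃ λ ρ → length ρ ≡ m × T (σ ++ ρ) ≡ true

Extendible : (List Bool → Bool) → List Bool → Set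
Extendible T σ = ∀ m → Alive T σ m

↾-+ : ∀ (f : Cantor) m n → f ↾ (m + n) ≡ f ↾ m ++ (λ i → f (m + i)) ↾ n
↾-+ f zero    n = refl
↾-+ f (suc m) n = cong (f 0 ∷_) (↾-+ (λ i → f (suc i)) m n)

path⇒extendible : ∀ {T F} → IsPath T F → ∀ n → Extendible T (F ↾ n)
path⇒extendible {T} {F} path n m =
  (λ i → F (n + i)) ↾ m , length-applyUpTo _ m , subst (λ σ → T σ ≡ true) (↾-+ F n m) (path (n + m))

deviation : Cantor → ℕ → List Bool
deviation g n = g ↾ n ∷ʳ not (g n)

dead-at-some-level : ExcludedMiddle 0ℓ → ∀ {T τ} → ¬ Extendible T τ → ∃ λ m → ¬ Alive T τ m
dead-at-some-level em dead = em⇒dne em (λ alive → dead (λ m → em⇒dne em (λ ¬alive → alive (m , ¬alive))))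

module _ {T : List Bool → Bool} (closed : PrefixClosed T) where

  T-prefix : ∀ σ ρ → T (σ ++ ρ) ≡ true → T σ ≡ true
  T-prefix σ []      inT = subst (λ x → T x ≡ true) (++-identityʳ σ) inT
  T-prefix σ (b ∷ ρ) inT = closed σ b (T-prefix (σ ∷ʳ b) ρ (subst (λ x → T x ≡ true) (sym (∷ʳ-++ σ b ρ)) inT))

  extendible⇒T : Extendible T σ → T σ ≡ true
  extendible⇒T {σ} ext = T-prefix σ _ (ext 0 .proj₂ .proj₂)

  alive-≤ : m ≤ n → Alive T σ n → Alive T σ m
  alive-≤ {m} {σ = σ} m≤n (ρ , refl , inT) =
    take m ρ , trans (length-take m ρ) (m≤n⇒m⊓n≡m m≤n) , T-prefix (σ ++ take m ρ) (drop m ρ) inT′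
    where
    inT′ : T ((σ ++ take m ρ) ++ drop m ρ) ≡ true
    inT′ = subst (λ x → T x ≡ true)
      (sym (trans (++-assoc σ (take m ρ) (drop m ρ)) (cong (σ ++_) (take++drop≡id m ρ)))) inT

  alive-suc : Alive T σ (suc m) → ∃ λ b → Alive T (σ ∷ʳ b) m
  alive-suc {σ} (b ∷ ρ , len , inT) = b , ρ , suc-injective len , subst (λ x → T x ≡ true) (sym (∷ʳ-++ σ b ρ)) inT

  extendible-sibling : Extendible T σ → ¬ Alive T (σ ∷ʳ b) m → Extendible T (σ ∷ʳ not b)
  extendible-sibling {σ} {b} {m} ext dead k with alive-suc (ext (suc (k + m)))
  ... | c , alive with c ≟ b
  ...   | yes refl = ⊥-elim (dead (alive-≤ (m≤n+m m k) alive))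
  ...   | no c≢b   = subst (λ x → Alive T (σ ∷ʳ x) k) (¬-not c≢b) (alive-≤ (m≤m+n k m) alive)

-- Searching for the level at which a child dies

leastWitness : ∀ {P : ℕ → Set} → Decidable P → ∀ {w} → P w → ∃ λ m → P m × (∀ k → k < m → ¬ P k)
leastWitness {P} P? {w} = <-rec (λ w → P w → Least) step w
  where
  Least : Set
  Least = ∃ λ m → P m × (∀ k → k < m → ¬ P k)
  step : ∀ w → (∀ {k} → k < w → P k → Least) → P w → Least
  step w below pw with anyUpTo? P? w
  ... | yes (k , k<w , pk) = below k<w pk
  ... | no none            = w , pw , λ k k<w pk → none (k , k<w , pk)

module TreeSearch {T : List Bool → Bool} (T-recursive : IsRecursiveTree T) where

  private
    cT : Code 1
    cT = T-recursive .proj₁ .proj₁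

    cT-correct : ∀ σ → Eval emptyOracle cT (codeStr σ ∷ []) (b2n (T σ))
    cT-correct = T-recursive .proj₁ .proj₂

    closed : PrefixClosed T
    closed = T-recursive .proj₂

  alive? : List Bool → ℕ → Bool
  alive? τ m = any (λ r → T (τ ++ strOf m r)) (downFrom (2 ^ m))

  alive?-sound : alive? τ m ≡ true → Alive T τ m
  alive?-sound {τ} {m} alive with find (any⁻ _ (downFrom (2 ^ m)) (Equivalence.from T-≡ alive))
  ... | r , r∈ , inT = strOf m r , length-strOf (∈-downFrom⁻ r∈) , Equivalence.to T-≡ inT

  alive?-complete : Alive T τ m → alive? τ m ≡ true
  alive?-complete {τ} (ρ , refl , inT) with strOf-surjective ρ
  ... | r , r<2^m , strOf≡ρ = Equivalence.to T-≡ (any⁺ _ (lose (∈-downFrom⁺ r<2^m) (Equivalence.from T-≡ inT′)))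
    where
    inT′ : T (τ ++ strOf (length ρ) r) ≡ true
    inT′ = subst (λ x → T (τ ++ x) ≡ true) (sym strOf≡ρ) inT

  alive?-false⇒dead : alive? τ m ≡ false → ¬ Alive T τ m
  alive?-false⇒dead dead alive = not-¬ (alive?-complete alive) dead

  bothAlive? : List Bool → ℕ → Bool
  bothAlive? σ m = alive? (σ ∷ʳ false) m ∧ alive? (σ ∷ʳ true) m

  child-dead⇒split : ∀ σ b m → alive? (σ ∷ʳ b) m ≡ false → bothAlive? σ m ≡ false
  child-dead⇒split σ false m dead rewrite dead = refl
  child-dead⇒split σ true  m dead rewrite dead = ∧-zeroʳ _

  extendible-children-without-split : (∀ m → bothAlive? σ m ≡ true) → ∀ b → Extendible T (σ ∷ʳ b)
  extendible-children-without-split {σ} unsplit b m =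
    alive?-sound (¬-not (λ dead → not-¬ (unsplit m) (child-dead⇒split σ b m dead)))

  extendible-child-at-split : Extendible T σ → bothAlive? σ m ≡ false →
                              Extendible T (σ ∷ʳ not (alive? (σ ∷ʳ false) m))
  extendible-child-at-split {σ} {m} ext split with alive? (σ ∷ʳ false) m in alive₀
  ... | true  = extendible-sibling closed ext (alive?-false⇒dead {σ ∷ʳ true} {m} split)
  ... | false = extendible-sibling closed ext (alive?-false⇒dead {σ ∷ʳ false} {m} alive₀)

  nonExtendible-child⇒split : ExcludedMiddle 0ℓ → ¬ Extendible T (σ ∷ʳ b) → ∃ λ m → bothAlive? σ m ≡ false
  nonExtendible-child⇒split {σ} {b} em nonExt = let m , dead = dead-at-some-level em {T} {σ ∷ʳ b} nonExt in
    m , child-dead⇒split σ b m (¬-not (dead ∘ alive?-sound))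

  child-at-split≡extendible-child : Extendible T σ → ¬ Extendible T (σ ∷ʳ not b) → bothAlive? σ m ≡ false →
                     not (alive? (σ ∷ʳ false) m) ≡ b
  child-at-split≡extendible-child {σ} {b} {m} ext nonExt split = decidable-stable (_ ≟ b) λ ≢b →
    nonExt (subst (λ c → Extendible T (σ ∷ʳ c)) (¬-not ≢b) (extendible-child-at-split {m = m} ext split))

  private
    E : Oracle
    E = emptyOracle

    eval-cT-extension : ∀ τ m r → Eval E cT (codeStr τ + 2 ^ length τ * pred (2 ^ m + r) ∷ []) (b2n (T (τ ++ strOf m r)))
    eval-cT-extension τ m r =
      subst (λ x → Eval E cT (x ∷ []) (b2n (T (τ ++ strOf m r)))) code-eq (cT-correct (τ ++ strOf m r))
      where
      code-eq : codeStr (τ ++ strOf m r) ≡ codeStr τ + 2 ^ length τ * pred (2 ^ m + r)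
      code-eq = trans (codeStr-++ τ (strOf m r)) (cong (λ x → codeStr τ + 2 ^ length τ * x) (codeStr-decode _))

  anyExtensionC : Code 4
  anyExtensionC = precC zeroC
    (app₂ orC (app₁ cT (projC (# 2) ⊕ projC (# 3) ⊗ app₁ predC (2^ᶜ projC (# 4) ⊕ projC (# 0)))) (projC (# 1)))

  eval-anyExtensionC : ∀ τ m j →
    Eval E anyExtensionC (j ∷ codeStr τ ∷ 2 ^ length τ ∷ m ∷ []) (b2n (any (λ r → T (τ ++ strOf m r)) (downFrom j)))
  eval-anyExtensionC τ m zero    = ev-prec0 ev-zero
  eval-anyExtensionC τ m (suc j) = ev-precS (eval-anyExtensionC τ m j)
    (eval-app₂ (eval-app₁ (eval-⊕ ev-proj (eval-⊗ ev-proj (eval-app₁ (eval-⊕ (eval-2^ᶜ ev-proj) ev-proj) (eval-predC _))))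
                          (eval-cT-extension τ m j))
               ev-proj (eval-orC _ _))

  aliveChildC : Bool → Code 3
  aliveChildC b = compC anyExtensionC
    (2^ᶜ projC (# 0) ∷ projC (# 1) ⊕ projC (# 2) ⊗ numeral (suc (b2n b)) ∷ projC (# 2) ⊗ numeral 2 ∷ projC (# 0) ∷ [])

  eval-aliveChildC : ∀ σ b m → Eval E (aliveChildC b) (m ∷ codeStr σ ∷ 2 ^ length σ ∷ []) (b2n (alive? (σ ∷ʳ b) m))
  eval-aliveChildC σ b m = ev-comp
    (evv-cons (eval-2^ᶜ ev-proj) (evv-cons (eval-⊕ ev-proj (eval-⊗ ev-proj (eval-numeral _)))
      (evv-cons (eval-⊗ ev-proj (eval-numeral 2)) (evv-cons ev-proj evv-nil))))
    (subst₂ (λ c d → Eval E anyExtensionC (2 ^ m ∷ c ∷ d ∷ m ∷ []) (b2n (alive? (σ ∷ʳ b) m)))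
      (codeStr-∷ʳ σ b) 2^length-∷ʳ (eval-anyExtensionC (σ ∷ʳ b) m (2 ^ m)))
    where
    2^length-∷ʳ : 2 ^ length (σ ∷ʳ b) ≡ 2 ^ length σ * 2
    2^length-∷ʳ = trans (cong (2 ^_) (length-++ σ)) (^-distribˡ-+-* 2 (length σ) 1)

  bothAliveC : Code 3
  bothAliveC = app₂ andC (aliveChildC false) (aliveChildC true)

  eval-bothAliveC : ∀ σ m → Eval E bothAliveC (m ∷ codeStr σ ∷ 2 ^ length σ ∷ []) (b2n (bothAlive? σ m))
  eval-bothAliveC σ m = eval-app₂ (eval-aliveChildC σ false m) (eval-aliveChildC σ true m) (eval-andC _ _)

  searchC : Code 2
  searchC = compC (aliveChildC false) (muC bothAliveC ∷ projC (# 0) ∷ projC (# 1) ∷ [])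

  searchC-halts : (∃ λ m → bothAlive? σ m ≡ false) →
    ∃ λ m → bothAlive? σ m ≡ false × Eval E searchC (codeStr σ ∷ 2 ^ length σ ∷ []) (b2n (alive? (σ ∷ʳ false) m))
  searchC-halts {σ} (w , split) with leastWitness (λ k → bothAlive? σ k ≟ false) {w} split
  ... | m , split-m , unsplit = m , split-m ,
    ev-comp (evv-cons (ev-mu halt continue) (evv-cons ev-proj (evv-cons ev-proj evv-nil))) (eval-aliveChildC σ false m)
    where
    halt : Eval E bothAliveC (m ∷ codeStr σ ∷ 2 ^ length σ ∷ []) 0
    halt = subst (λ x → Eval E bothAliveC _ (b2n x)) split-m (eval-bothAliveC σ m)
    continue : ∀ k → k < m → Σ ℕ λ v → Eval E bothAliveC (k ∷ codeStr σ ∷ 2 ^ length σ ∷ []) (suc v)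
    continue k k<m = 0 , subst (λ x → Eval E bothAliveC _ (b2n x)) (¬-not (unsplit k k<m)) (eval-bothAliveC σ k)

-- Paths computed by DNR₂ functions

module DNR₂Path (em : ExcludedMiddle 0ℓ) {T : List Bool → Bool} (T-recursive : IsRecursiveTree T)
                {h : Cantor} (dnr : DNR₂ h) where

  open TreeSearch T-recursive

  bit : List Bool → Bool
  bit σ = h (encode (specialise searchC (codeStr σ) (2 ^ length σ)))

  bit-≡-not-search : ∀ {σ b} → Eval emptyOracle searchC (codeStr σ ∷ 2 ^ length σ ∷ []) (b2n b) → bit σ ≡ not b
  -- The implicit arguments are given because inferring them makes Agda evaluate Gödel numbers.
  bit-≡-not-search {σ} halts = ¬-not (DNR₂-avoids-specialise dnr {searchC} {codeStr σ} {2 ^ length σ} halts ∘ cong b2n)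

  extendible-∷ʳ-bit : Extendible T σ → Extendible T (σ ∷ʳ bit σ)
  extendible-∷ʳ-bit {σ} ext = case em {∃ λ m → bothAlive? σ m ≡ false} of λ where
    (no unsplit) → extendible-children-without-split (λ m → ¬-not (λ split → unsplit (m , split))) (bit σ)
    (yes split)  → let m , split-m , halts = searchC-halts split in
      subst (λ b → Extendible T (σ ∷ʳ b)) (sym (bit-≡-not-search halts)) (extendible-child-at-split {m = m} ext split-m)

  branch : ℕ → List Bool
  branch zero    = []
  branch (suc n) = branch n ∷ʳ bit (branch n)

  path : Cantor
  path n = bit (branch n)

  path-↾ : ∀ n → path ↾ n ≡ branch n
  path-↾ zero    = refl
  path-↾ (suc n) = trans (sym (applyUpTo-∷ʳ path n)) (cong (_∷ʳ path n) (path-↾ n))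

  path-isPath : Extendible T [] → IsPath T path
  path-isPath ext₀ n =
    subst (λ σ → T σ ≡ true) (sym (path-↾ n)) (extendible⇒T (T-recursive .proj₂) (extendible-branch n))
    where
    extendible-branch : ∀ n → Extendible T (branch n)
    extendible-branch zero    = ext₀
    extendible-branch (suc n) = extendible-∷ʳ-bit (extendible-branch n)

  bitC : Code 2
  bitC = app₁ oracleC (specialiseIndexC searchC)

  eval-bitC : ∀ σ → Eval (λ k → b2n (h k)) bitC (codeStr σ ∷ 2 ^ length σ ∷ []) (b2n (bit σ))
  eval-bitC σ = eval-app₁ (eval-specialiseIndexC searchC (codeStr σ) (2 ^ length σ)) ev-oracle

  path≤Th : path ≤T h
  path≤Th = extendC bitC , extendC-computes λ n →
    subst (λ σ → Eval (λ k → b2n (h k)) bitC (codeStr σ ∷ 2 ^ length σ ∷ []) (b2n (path n)))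
      (sym (path-↾ n)) (eval-bitC (branch n))

DNR₂-computes-path : ExcludedMiddle 0ℓ → ∀ {T} → IsRecursiveTree T → Extendible T [] →
                     ∀ {h} → DNR₂ h → ∃ λ F → IsPath T F × F ≤T h
DNR₂-computes-path em T-recursive ext₀ dnr = path , path-isPath ext₀ , path≤Th
  where open DNR₂Path em T-recursive dnr

-- Isolated paths

isolatedPath-recursive : ExcludedMiddle 0ℓ → ∀ {T g} → IsRecursiveTree T → IsPath T g →
                         (∀ n → ¬ Extendible T (deviation g n)) → Recursive g
isolatedPath-recursive em {T} {g} T-recursive g-path isolated = extendC nextC , extendC-computes next-bit
  where
  open TreeSearch T-recursive

  nextC : Code 2
  nextC = app₁ notC searchC

  next-bit : ∀ n → Eval emptyOracle nextC (codeStr (g ↾ n) ∷ 2 ^ length (g ↾ n) ∷ []) (b2n (g n))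
  next-bit n = let m , split , halts = searchC-halts (nonExtendible-child⇒split em (isolated n)) in
    subst (λ b → Eval emptyOracle nextC _ (b2n b))
      (child-at-split≡extendible-child {m = m} (path⇒extendible {T} g-path n) (isolated n) split)
      (eval-app₁ halts (eval-notC _))

above : List Bool → (List Bool → Bool) → List Bool → Bool
above σ T τ = T (σ ++ τ)

above-recursive : ∀ {T} σ → IsRecursiveTree T → IsRecursiveTree (above σ T)
above-recursive {T} σ ((cT , cT-correct) , closed) = (cT′ , cT′-correct) , closed′
  where
  cT′ : Code 1
  cT′ = app₁ cT (numeral (codeStr σ) ⊕ numeral (2 ^ length σ) ⊗ projC (# 0))
  cT′-correct : ∀ τ → Eval emptyOracle cT′ (codeStr τ ∷ []) (b2n (T (σ ++ τ)))
  cT′-correct τ = eval-app₁ (eval-⊕ (eval-numeral _) (eval-⊗ (eval-numeral _) ev-proj))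
    (subst (λ x → Eval emptyOracle cT (x ∷ []) (b2n (T (σ ++ τ)))) (codeStr-++ σ τ) (cT-correct (σ ++ τ)))
  closed′ : PrefixClosed (above σ T)
  closed′ τ b inT = closed (σ ++ τ) b (subst (λ x → T x ≡ true) (sym (++-assoc σ τ [ b ])) inT)

infixr 5 _++ᶜ_
_++ᶜ_ : List Bool → Cantor → Cantor
([]      ++ᶜ f) n       = f n
((b ∷ σ) ++ᶜ f) zero    = b
((b ∷ σ) ++ᶜ f) (suc n) = (σ ++ᶜ f) n

++ᶜ-↾ : ∀ σ f k → (σ ++ᶜ f) ↾ (length σ + k) ≡ σ ++ f ↾ k
++ᶜ-↾ []      f k = refl
++ᶜ-↾ (b ∷ σ) f k = cong (b ∷_) (++ᶜ-↾ σ f k)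

++ᶜ-at-length : ∀ σ b f → ((σ ∷ʳ b) ++ᶜ f) (length σ) ≡ b
++ᶜ-at-length []      b f = refl
++ᶜ-at-length (c ∷ σ) b f = ++ᶜ-at-length σ b f

++ᶜ-deviation≢ : ∀ g n F → ¬ (∀ i → (deviation g n ++ᶜ F) i ≡ g i)
++ᶜ-deviation≢ g n F same = not-¬ refl (trans (sym (same n)) deviates)
  where
  deviates : (deviation g n ++ᶜ F) n ≡ not (g n)
  deviates = subst (λ i → (deviation g n ++ᶜ F) i ≡ not (g n)) (length-applyUpTo g n) (++ᶜ-at-length (g ↾ n) (not (g n)) F)

++ᶜ-isPath : ∀ {T} → PrefixClosed T → ∀ σ {f} → IsPath (above σ T) f → IsPath T (σ ++ᶜ f)
++ᶜ-isPath {T} closed σ {f} f-path k = T-prefix closed _ _ (subst (λ τ → T τ ≡ true) long-prefix (f-path k))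
  where
  long-prefix : σ ++ f ↾ k ≡ (σ ++ᶜ f) ↾ k ++ (λ i → (σ ++ᶜ f) (k + i)) ↾ length σ
  long-prefix = begin
    σ ++ f ↾ k                                                  ≡⟨ ++ᶜ-↾ σ f k ⟨
    (σ ++ᶜ f) ↾ (length σ + k)                                  ≡⟨ cong ((σ ++ᶜ f) ↾_) (+-comm (length σ) k) ⟩
    (σ ++ᶜ f) ↾ (k + length σ)                                  ≡⟨ ↾-+ (σ ++ᶜ f) k (length σ) ⟩
    (σ ++ᶜ f) ↾ k ++ (λ i → (σ ++ᶜ f) (k + i)) ↾ length σ       ∎
    where open ≡-Reasoning

++ᶜ-≤T : ∀ σ {f h} → f ≤T h → (σ ++ᶜ f) ≤T h
++ᶜ-≤T []      f≤h             = f≤h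
++ᶜ-≤T (b ∷ σ) {f} {h} f≤h with ++ᶜ-≤T σ f≤h
... | c , c-correct = consC , eval
  where
  consC : Code 1
  consC = precC (numeral (b2n b)) (app₁ c (projC (# 0)))
  eval : ∀ n → Eval (λ k → b2n (h k)) consC (n ∷ []) (b2n (((b ∷ σ) ++ᶜ f) n))
  eval zero    = ev-prec0 (eval-numeral _)
  eval (suc n) = ev-precS (eval n) (eval-app₁ ev-proj (c-correct n))

mainTheorem16 : ExcludedMiddle 0ℓ →
    (Q : Class) → IsΠ⁰₁ Q → ¬ (Σ Cantor (λ f → Q f × Recursive f)) →
    (g : Cantor) → Q g → (Q ∖｛ g ｝) ≤w DNR₂
mainTheorem16 em Q (T , T-recursive , Q⇔path) no-recursive g Qg h dnr
  with em {∃ λ n → Extendible T (deviation g n)}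
... | no isolated = ⊥-elim (no-recursive (g , Qg ,
      isolatedPath-recursive em T-recursive (Q⇔path g .proj₁ Qg) (λ n ext → isolated (n , ext))))
... | yes (n , ext) =
  -- ext also types as Extendible (above (deviation g n) T) [], by unfolding.
  let F , F-path , F≤h = DNR₂-computes-path em (above-recursive (deviation g n) T-recursive) ext dnr in
  deviation g n ++ᶜ F ,
  (Q⇔path _ .proj₂ (++ᶜ-isPath (T-recursive .proj₂) (deviation g n) F-path) , ++ᶜ-deviation≢ g n F) ,
  ++ᶜ-≤T (deviation g n) F≤h
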